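{- Let $\nu\ge 2$. For $x_0\ge 0$ define \[ R_{\nu}(x_0)=\sum_{\substack{n\in\mathbb{N},\ \mathbf{m}\in\mathbb{Z}^{\nu}\\ |\mathbf{m}|/n=x_0}}\frac{\gamma(n)}{n^{\nu+1}}, \] i.e. the coefficient of $\bigl(s^2+(2\pi x_0)^2\bigr)^{ -t}$ in the series $\Phi(s,\mathbf{0},t;\nu)=\sum_{n\in\mathbb{N},\mathbf{m}\in\mathbb{Z}^\nu}\frac{\gamma(n)}{n^{\nu+1}}\bigl(s^2+(2\pi|\mathbf{m}|/n)^2\bigr)^{ -t}$. Let $\tilde m,\tilde n$ be positive integers with $\gcd(\tilde m,\tilde n)=1$. Then \[ R_{\nu}\Bigl(\frac{\tilde m}{\tilde n}\Bigr)=\frac{1}{\tilde n^{\nu+1}}\sum_{k=1}^{\infty}\frac{\gamma(k\tilde n)\,r_{\nu}(k^2\tilde m^2)}{k^{\nu+1}}. \]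
   Context: $\gamma(n)=\prod_{p\mid n,\ p\text{ prime}}(1-p)$; $|\mathbf{m}|$ is the Euclidean norm; $r_{\nu}(n)=\#\{(m_1,\dots,m_\nu)\in\mathbb{Z}^\nu: m_1^2+\cdots+m_\nu^2=n\}$. -}

module Defs where

open import Data.Nat as ℕ using (ℕ; zero; suc; NonZero)
open import Data.Nat.Properties using (m^n≢0)
open import Data.Nat.Primality using (prime?)
open import Data.Nat.Divisibility using (_∣?_)
open import Data.Integer as ℤ using (ℤ; +_)
open import Data.Rational as ℚ using (ℚ)
open import Data.List using (List; []; _∷_; map; filter; length; foldr; upTo; concatMap)
open import Data.Vec using (Vec; []; _∷_)
open import Relation.Nullary.Decidable using (_×-dec_)

γ : ℕ → ℤ
γ n = foldr ℤ._*_ (+ 1)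
        (map (λ p → + 1 ℤ.- + p)
             (filter (λ p → prime? p ×-dec p ∣? n) (upTo (suc n))))

box : ℕ → List ℤ
box B = map (λ i → + i ℤ.- + B) (upTo (suc (2 ℕ.* B)))

vecs : (ν : ℕ) → List ℤ → List (Vec ℤ ν)
vecs zero xs = [] ∷ []
vecs (suc ν) xs = concatMap (λ x → map (x ∷_) (vecs ν xs)) xs

normSq : ∀ {ν} → Vec ℤ ν → ℤ
normSq [] = + 0
normSq (x ∷ v) = x ℤ.* x ℤ.+ normSq v

-- r_ν(n) = #{m ∈ ℤ^ν : |m|² = n}.  Every solution has |m_i| ≤ n, so
-- enumerating the box [-n,n]^ν counts all of them.
r : ℕ → ℕ → ℕ
r ν n = length (filter (λ v → normSq v ℤ.≟ + n) (vecs ν (box n)))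

-- #{m ∈ ℤ^ν : |m|/n = x₀}, for n ≥ 1 and x₀ ∈ ℚ (x₀ ≥ 0 intended);
-- |m|/n = x₀ with x₀ ≥ 0 is |m|² = (x₀ n)².  Every solution has
-- |m_i| ≤ x₀ n ≤ |numerator x₀| · n, so the box enumeration is complete.
countFiber : ℕ → ℚ → ℕ → ℕ
countFiber ν x₀ n =
  length (filter (λ v → (normSq v ℚ./ 1) ℚ.≟ ((x₀ ℚ.* (+ n ℚ./ 1)) ℚ.* (x₀ ℚ.* (+ n ℚ./ 1))))
                 (vecs ν (box (ℤ.∣ ℚ.↥ x₀ ∣ ℕ.* n))))

Σ₁ : ℕ → (ℕ → ℚ) → ℚ
Σ₁ zero f = ℚ.0ℚ
Σ₁ (suc N) f = Σ₁ N f ℚ.+ f (suc N)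

Rterm : ℕ → ℚ → ℕ → ℚ
Rterm ν x₀ zero = ℚ.0ℚ
Rterm ν x₀ (suc k) =
  (γ (suc k) ℤ.* + countFiber ν x₀ (suc k)) ℚ./ (suc k ℕ.^ suc ν)
  where instance _ = m^n≢0 (suc k) (suc ν)

Rpartial : ℕ → ℚ → ℕ → ℚ
Rpartial ν x₀ N = Σ₁ N (Rterm ν x₀)

RHSterm : ℕ → ℕ → ℕ → ℕ → ℚ
RHSterm ν m̃ ñ zero = ℚ.0ℚ
RHSterm ν m̃ ñ (suc j) =
  (γ (k ℕ.* ñ) ℤ.* + r ν (k ℕ.* k ℕ.* (m̃ ℕ.* m̃))) ℚ./ (k ℕ.^ suc ν)
  where
    k = suc j
    instance _ = m^n≢0 (suc j) (suc ν)

-- A vector m ∈ ℤ^ν lies in the fiber |m|/n = m̃/ñ iff ñ²|m|² = m̃²n². Since gcd(m̃, ñ) = 1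
-- this forces ñ ∣ n, so only the terms n = kñ of R_ν survive, and for those the fiber is the
-- set of representations of k²m̃² as a sum of ν squares. As (kñ)^(ν+1) = ñ^(ν+1) k^(ν+1), the
-- partial sum up to N regroups into ñ^-(ν+1) times the partial sum up to ⌊N/ñ⌋ on the right.
-- The finite boxes enumerated by countFiber and r differ in size, but both contain the box of
-- side m̃k, which already holds every vector of squared norm (m̃k)²: adding a layer to a box
-- only adds vectors with an entry of square larger than the target.

module Submission where

open import Defs
open import Data.Nat as ℕ using (ℕ; zero; suc; _≤_; _<_; _≤′_; ≤′-refl; ≤′-step; NonZero)
open import Data.Nat.Properties using (m^n≢0)
open import Data.Nat.GCD using (gcd)
open import Data.Integer using (+_)
open import Data.Rational as ℚ using (ℚ)
open import Relation.Binary.PropositionalEquality using (_≡_)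

open import Data.Bool using (true; false)
open import Data.Integer as ℤ using (ℤ; 0ℤ; -[1+_]; _⊖_)
import Data.Integer.Properties as ℤP
import Data.Integer.Tactic.RingSolver as ℤ-Solver
open import Data.List using (List; []; _∷_; [_]; _++_; _∷ʳ_; map; filter; length; concatMap; upTo; applyUpTo)
open import Data.List.Properties
  using (filter-++; filter-≐; filter-none; length-++; length-map; map-cong; map-++; map-upTo; applyUpTo-∷ʳ)
import Data.List.Relation.Unary.All as All
open import Data.Nat.Coprimality using (Coprime; coprime-/gcd; coprime-divisor; gcd≡1⇒coprime)
import Data.Nat.Coprimality as Coprimality
open import Data.Nat.Divisibility using (_∣_; divides; ∣-refl; ∣⇒≤; ∣m+n∣m⇒∣n; n∣m*n; m*n∣⇒m∣; *-cancelʳ-∣)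
open import Data.Nat.DivMod using (_/_; _%_; m≡m%n+[m/n]*n; m%n<n; m/n*n≡m)
open import Data.Nat.GCD using (gcd[m,n]∣m; gcd[m,n]∣n; gcd[m,n]≢0)
open import Data.Nat.ListAction using (sum)
open import Data.Nat.ListAction.Properties using (sum-++)
import Data.Nat.Properties as ℕP
import Data.Nat.Tactic.RingSolver as ℕ-Solver
open import Data.Product using (_,_)
import Data.Rational.Properties as ℚP
open import Data.Rational.Unnormalised as ℚᵘ using (mkℚᵘ; *≡*) renaming (_≃_ to _≃ᵘ_)
import Data.Rational.Unnormalised.Properties as ℚᵘP
open import Data.Sum using (inj₁)
open import Data.Vec as Vec using (Vec; []; _∷_)
open import Function using (_∘_; _⇔_; mk⇔; Equivalence)
open import Relation.Nullary using (¬_; does)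
open import Relation.Unary using (Pred; Decidable)
open import Relation.Binary.PropositionalEquality
  using (refl; sym; trans; cong; cong₂; subst; subst₂; _≗_; module ≡-Reasoning)

private
  variable
    A B : Set

filter-map : ∀ {p} {P : Pred B p} (P? : Decidable P) (f : A → B) →
             filter P? ∘ map f ≗ map f ∘ filter (P? ∘ f)
filter-map P? f [] = refl
filter-map P? f (x ∷ xs) with does (P? (f x))
... | true  = cong (f x ∷_) (filter-map P? f xs)
... | false = filter-map P? f xs

length-filter-concatMap : ∀ {p} {P : Pred B p} (P? : Decidable P) (f : A → List B) xs →
  length (filter P? (concatMap f xs)) ≡ sum (map (length ∘ filter P? ∘ f) xs)
length-filter-concatMap P? f [] = refl
length-filter-concatMap P? f (x ∷ xs) = begin
  length (filter P? (f x ++ concatMap f xs))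
    ≡⟨ cong length (filter-++ P? (f x) (concatMap f xs)) ⟩
  length (filter P? (f x) ++ filter P? (concatMap f xs))
    ≡⟨ length-++ (filter P? (f x)) ⟩
  length (filter P? (f x)) ℕ.+ length (filter P? (concatMap f xs))
    ≡⟨ cong (length (filter P? (f x)) ℕ.+_) (length-filter-concatMap P? f xs) ⟩
  length (filter P? (f x)) ℕ.+ sum (map (length ∘ filter P? ∘ f) xs) ∎
  where open ≡-Reasoning

applyUpTo-cong : ∀ {f g : ℕ → A} → f ≗ g → applyUpTo f ≗ applyUpTo g
applyUpTo-cong f≗g zero    = refl
applyUpTo-cong f≗g (suc n) = cong₂ _∷_ (f≗g 0) (applyUpTo-cong (f≗g ∘ suc) n)

m≤m*m : ∀ m → m ≤ m ℕ.* m
m≤m*m zero    = ℕ.z≤n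
m≤m*m (suc m) = ℕP.m≤m*n (suc m) (suc m)

^-distribʳ-* : ∀ m n o → (m ℕ.* n) ℕ.^ o ≡ m ℕ.^ o ℕ.* n ℕ.^ o
^-distribʳ-* m n zero    = refl
^-distribʳ-* m n (suc o) = trans (cong ((m ℕ.* n) ℕ.*_) (^-distribʳ-* m n o))
                                 (ℕP.[m*n]*[o*p]≡[m*o]*[n*p] m n (m ℕ.^ o) (n ℕ.^ o))

m*m∣n*n⇒m∣n : ∀ m n .{{_ : NonZero m}} → m ℕ.* m ∣ n ℕ.* n → m ∣ n
m*m∣n*n⇒m∣n m n m²∣n² = subst (_∣ n) g≡m (gcd[m,n]∣n m n)
  where
  g = gcd m n
  instance
    g≢0 : NonZero g
    g≢0 = ℕ.≢-nonZero (gcd[m,n]≢0 m n (inj₁ (ℕ.≢-nonZero⁻¹ m)))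
    g*g≢0 : NonZero (g ℕ.* g)
    g*g≢0 = ℕP.m*n≢0 g g
  m′ = m / g
  n′ = n / g
  m′*g≡m : m′ ℕ.* g ≡ m
  m′*g≡m = m/n*n≡m (gcd[m,n]∣m m n)
  n′*g≡n : n′ ℕ.* g ≡ n
  n′*g≡n = m/n*n≡m (gcd[m,n]∣n m n)
  m′²∣n′² : (m′ ℕ.* m′) ℕ.* (g ℕ.* g) ∣ (n′ ℕ.* n′) ℕ.* (g ℕ.* g)
  m′²∣n′² = subst₂ _∣_ (trans (cong (λ x → x ℕ.* x) (sym m′*g≡m)) (ℕP.[m*n]*[o*p]≡[m*o]*[n*p] m′ g m′ g))
                       (trans (cong (λ x → x ℕ.* x) (sym n′*g≡n)) (ℕP.[m*n]*[o*p]≡[m*o]*[n*p] n′ g n′ g)) m²∣n²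
  -- m′ and n′ are coprime, so m′ ∣ n′ ⋅ n′ forces m′ ∣ n′ and hence m′ = 1.
  m′≡1 : m′ ≡ 1
  m′≡1 = coprime-/gcd m n (∣-refl , coprime-divisor (coprime-/gcd m n)
                                       (m*n∣⇒m∣ m′ m′ (*-cancelʳ-∣ (g ℕ.* g) m′²∣n′²)))
  g≡m : g ≡ m
  g≡m = trans (sym (ℕP.*-identityˡ g)) (trans (cong (ℕ._* g) (sym m′≡1)) m′*g≡m)

i*i≡+∣i∣*∣i∣ : ∀ i → i ℤ.* i ≡ + (ℤ.∣ i ∣ ℕ.* ℤ.∣ i ∣)
i*i≡+∣i∣*∣i∣ (+ n)    = sym (ℤP.pos-* n n)
i*i≡+∣i∣*∣i∣ -[1+ n ] = refl

i+j≡k⇔j≡k-i : ∀ i j k → (i ℤ.+ j ≡ k) ⇔ (j ≡ k ℤ.- i)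
i+j≡k⇔j≡k-i i j k = mk⇔ (λ { refl → cancel i j }) (λ { refl → uncancel i k })
  where
  cancel : ∀ i j → j ≡ (i ℤ.+ j) ℤ.- i
  cancel = ℤ-Solver.solve-∀
  uncancel : ∀ i k → i ℤ.+ (k ℤ.- i) ≡ k
  uncancel = ℤ-Solver.solve-∀

toℚᵘ-/ : ∀ i n .{{_ : NonZero n}} → ℚ.toℚᵘ (i ℚ./ n) ≃ᵘ (i ℚᵘ./ n)
toℚᵘ-/ i (suc n) = ℚP.toℚᵘ-fromℚᵘ (mkℚᵘ i n)

/-* : ∀ i j m n .{{_ : NonZero m}} .{{_ : NonZero n}} →
      (i ℚ./ m) ℚ.* (j ℚ./ n) ≡ ((i ℤ.* j) ℚ./ (m ℕ.* n)) {{ℕP.m*n≢0 m n}}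
/-* i j m@(suc _) n@(suc _) = ℚP.toℚᵘ-injective (begin
  ℚ.toℚᵘ ((i ℚ./ m) ℚ.* (j ℚ./ n))              ≈⟨ ℚP.toℚᵘ-homo-* (i ℚ./ m) (j ℚ./ n) ⟩
  ℚ.toℚᵘ (i ℚ./ m) ℚᵘ.* ℚ.toℚᵘ (j ℚ./ n)        ≈⟨ ℚᵘP.*-cong (toℚᵘ-/ i m) (toℚᵘ-/ j n) ⟩
  (i ℚᵘ./ m) ℚᵘ.* (j ℚᵘ./ n)                    ≡⟨⟩
  (i ℤ.* j) ℚᵘ./ (m ℕ.* n)                      ≈⟨ toℚᵘ-/ (i ℤ.* j) (m ℕ.* n) ⟨
  ℚ.toℚᵘ ((i ℤ.* j) ℚ./ (m ℕ.* n))              ∎)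
  where open ℚᵘP.≃-Reasoning

/≡/⇔ : ∀ i j m n .{{_ : NonZero m}} .{{_ : NonZero n}} →
       (i ℚ./ m ≡ j ℚ./ n) ⇔ (i ℤ.* + n ≡ j ℤ.* + m)
/≡/⇔ i j (suc m) (suc n) =
  mk⇔ (ℚᵘP.drop-*≡* ∘ ℚP./-injective-≃ (mkℚᵘ i m) (mkℚᵘ j n)) (ℚP.fromℚᵘ-cong {mkℚᵘ i m} {mkℚᵘ j n} ∘ *≡*)

↥-/-coprime : ∀ m n .{{_ : NonZero n}} → gcd m n ≡ 1 → ℚ.↥ (+ m ℚ./ n) ≡ + m
↥-/-coprime m n coprime = begin
  ℚ.↥ (+ m ℚ./ n)                        ≡⟨ ℤP.*-identityʳ (ℚ.↥ (+ m ℚ./ n)) ⟨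
  ℚ.↥ (+ m ℚ./ n) ℤ.* + 1                ≡⟨ cong (λ g → ℚ.↥ (+ m ℚ./ n) ℤ.* + g) coprime ⟨
  ℚ.↥ (+ m ℚ./ n) ℤ.* + gcd m n          ≡⟨ ℚP.↥-/ (+ m) n ⟩
  + m                                    ∎
  where open ≡-Reasoning

square-of-/ : ∀ a d n .{{_ : NonZero d}} →
  ((+ a ℚ./ d) ℚ.* (+ n ℚ./ 1)) ℚ.* ((+ a ℚ./ d) ℚ.* (+ n ℚ./ 1))
    ≡ (+ ((a ℕ.* n) ℕ.* (a ℕ.* n)) ℚ./ (d ℕ.* d)) {{ℕP.m*n≢0 d d}}
square-of-/ a d n = begin
  ((+ a ℚ./ d) ℚ.* (+ n ℚ./ 1)) ℚ.* ((+ a ℚ./ d) ℚ.* (+ n ℚ./ 1))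
    ≡⟨ cong (λ q → q ℚ.* q) a/d*n≡an/d ⟩
  (+ (a ℕ.* n) ℚ./ d) ℚ.* (+ (a ℕ.* n) ℚ./ d)
    ≡⟨ /-* (+ (a ℕ.* n)) (+ (a ℕ.* n)) d d ⟩
  (+ (a ℕ.* n) ℤ.* + (a ℕ.* n)) ℚ./ (d ℕ.* d)
    ≡⟨ ℚP./-cong (sym (ℤP.pos-* (a ℕ.* n) (a ℕ.* n))) refl ⟩
  + ((a ℕ.* n) ℕ.* (a ℕ.* n)) ℚ./ (d ℕ.* d) ∎
  where
  open ≡-Reasoning
  instance _ = ℕP.m*n≢0 d d
  a/d*n≡an/d : (+ a ℚ./ d) ℚ.* (+ n ℚ./ 1) ≡ + (a ℕ.* n) ℚ./ d
  a/d*n≡an/d = trans (/-* (+ a) (+ n) d 1) (ℚP./-cong {{ℕP.m*n≢0 d 1}} (sym (ℤP.pos-* a n)) (ℕP.*-identityʳ d))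

Σ₁-*ˡ : ∀ c N f → Σ₁ N (λ k → c ℚ.* f k) ≡ c ℚ.* Σ₁ N f
Σ₁-*ˡ c zero    f = sym (ℚP.*-zeroʳ c)
Σ₁-*ˡ c (suc N) f = trans (cong (ℚ._+ c ℚ.* f (suc N)) (Σ₁-*ˡ c N f))
                          (sym (ℚP.*-distribˡ-+ c (Σ₁ N f) (f (suc N))))

Σ₁-vanishing-tail : ∀ f M r → (∀ i → i < r → f (suc i ℕ.+ M) ≡ ℚ.0ℚ) → Σ₁ (r ℕ.+ M) f ≡ Σ₁ M f
Σ₁-vanishing-tail f M zero    _      = refl
Σ₁-vanishing-tail f M (suc r) tail≡0 = begin
  Σ₁ (r ℕ.+ M) f ℚ.+ f (suc r ℕ.+ M) ≡⟨ cong (Σ₁ (r ℕ.+ M) f ℚ.+_) (tail≡0 r (ℕP.n<1+n r)) ⟩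
  Σ₁ (r ℕ.+ M) f ℚ.+ ℚ.0ℚ            ≡⟨ ℚP.+-identityʳ (Σ₁ (r ℕ.+ M) f) ⟩
  Σ₁ (r ℕ.+ M) f                     ≡⟨ Σ₁-vanishing-tail f M r (λ i i<r → tail≡0 i (ℕP.m<n⇒m<1+n i<r)) ⟩
  Σ₁ M f                             ∎
  where open ≡-Reasoning

Σ₁-sparse : ∀ d .{{_ : NonZero d}} (f g : ℕ → ℚ) →
  (∀ n → ¬ d ∣ n → f n ≡ ℚ.0ℚ) → (∀ k → f (k ℕ.* d) ≡ g k) →
  ∀ N → Σ₁ N f ≡ Σ₁ (N / d) g
Σ₁-sparse d@(suc p) f g f-vanishes f-multiple N = begin
  Σ₁ N f                         ≡⟨ cong (λ n → Σ₁ n f) (m≡m%n+[m/n]*n N d) ⟩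
  Σ₁ (N % d ℕ.+ N / d ℕ.* d) f   ≡⟨ Σ₁-vanishing-tail f (N / d ℕ.* d) (N % d)
                                      (λ i i<r → f-vanishes _ (off-multiple (N / d) (ℕP.≤-<-trans i<r (m%n<n N d)))) ⟩
  Σ₁ (N / d ℕ.* d) f             ≡⟨ multiples (N / d) ⟩
  Σ₁ (N / d) g                   ∎
  where
  open ≡-Reasoning
  off-multiple : ∀ q {i} → suc i < d → ¬ d ∣ suc i ℕ.+ q ℕ.* d
  off-multiple q {i} 1+i<d d∣ = ℕP.<⇒≱ 1+i<d
    (∣⇒≤ (∣m+n∣m⇒∣n (subst (d ∣_) (ℕP.+-comm (suc i) (q ℕ.* d)) d∣) (n∣m*n q)))
  -- Σ₁ (suc q * d) unfolds to Σ₁ (p + q * d) + f (suc q * d), since d = suc p.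
  multiples : ∀ q → Σ₁ (q ℕ.* d) f ≡ Σ₁ q g
  multiples zero    = refl
  multiples (suc q) = cong₂ ℚ._+_
    (trans (Σ₁-vanishing-tail f (q ℕ.* d) p (λ i i<p → f-vanishes _ (off-multiple q (ℕ.s≤s i<p))))
           (multiples q))
    (f-multiple (suc q))

normSq-nonneg : ∀ {ν} (v : Vec ℤ ν) → 0ℤ ℤ.≤ normSq v
normSq-nonneg []      = ℤ.+≤+ ℕ.z≤n
normSq-nonneg (x ∷ v) =
  ℤP.+-mono-≤ (subst (0ℤ ℤ.≤_) (sym (i*i≡+∣i∣*∣i∣ x)) (ℤ.+≤+ ℕ.z≤n)) (normSq-nonneg v)

countNormSq : ℕ → List ℤ → ℤ → ℕ
countNormSq ν xs T = length (filter (λ v → normSq v ℤ.≟ T) (vecs ν xs))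

countNormSq-suc : ∀ ν xs T →
  countNormSq (suc ν) xs T ≡ sum (map (λ x → countNormSq ν xs (T ℤ.- x ℤ.* x)) xs)
countNormSq-suc ν xs T =
  trans (length-filter-concatMap (λ v → normSq v ℤ.≟ T) (λ x → map (x Vec.∷_) (vecs ν xs)) xs)
        (cong sum (map-cong first-coordinate xs))
  where
  first-coordinate : ∀ x →
    length (filter (λ v → normSq v ℤ.≟ T) (map (x Vec.∷_) (vecs ν xs))) ≡ countNormSq ν xs (T ℤ.- x ℤ.* x)
  first-coordinate x = begin
    length (filter (λ v → normSq v ℤ.≟ T) (map (x Vec.∷_) (vecs ν xs)))
      ≡⟨ cong length (filter-map (λ v → normSq v ℤ.≟ T) (x Vec.∷_) (vecs ν xs)) ⟩
    length (map (x Vec.∷_) (filter (λ v → x ℤ.* x ℤ.+ normSq v ℤ.≟ T) (vecs ν xs)))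
      ≡⟨ length-map (x Vec.∷_) (filter (λ v → x ℤ.* x ℤ.+ normSq v ℤ.≟ T) (vecs ν xs)) ⟩
    length (filter (λ v → x ℤ.* x ℤ.+ normSq v ℤ.≟ T) (vecs ν xs))
      ≡⟨ cong length (filter-≐ (λ v → x ℤ.* x ℤ.+ normSq v ℤ.≟ T) (λ v → normSq v ℤ.≟ T ℤ.- x ℤ.* x)
                               ((λ {v} → to {v}) , (λ {v} → from {v})) (vecs ν xs)) ⟩
    countNormSq ν xs (T ℤ.- x ℤ.* x) ∎
    where
    open ≡-Reasoning
    to : ∀ {v : Vec ℤ ν} → x ℤ.* x ℤ.+ normSq v ≡ T → normSq v ≡ T ℤ.- x ℤ.* x
    to {v} = Equivalence.to (i+j≡k⇔j≡k-i (x ℤ.* x) (normSq v) T)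
    from : ∀ {v : Vec ℤ ν} → normSq v ≡ T ℤ.- x ℤ.* x → x ℤ.* x ℤ.+ normSq v ≡ T
    from {v} = Equivalence.from (i+j≡k⇔j≡k-i (x ℤ.* x) (normSq v) T)

countNormSq-beyond : ∀ ν xs {T} x → T ℤ.< x ℤ.* x → countNormSq ν xs (T ℤ.- x ℤ.* x) ≡ 0
countNormSq-beyond ν xs {T} x T<x² = cong length (filter-none _ (All.universal excluded (vecs ν xs)))
  where
  excluded : ∀ v → ¬ normSq v ≡ T ℤ.- x ℤ.* x
  excluded v e = ℤP.<⇒≱ T<x² (begin
    x ℤ.* x              ≡⟨ sym (ℤP.+-identityʳ (x ℤ.* x)) ⟩
    x ℤ.* x ℤ.+ 0ℤ       ≤⟨ ℤP.+-monoʳ-≤ (x ℤ.* x) (normSq-nonneg v) ⟩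
    x ℤ.* x ℤ.+ normSq v ≡⟨ Equivalence.from (i+j≡k⇔j≡k-i (x ℤ.* x) (normSq v) T) e ⟩
    T                    ∎)
    where open ℤP.≤-Reasoning

countNormSq-drop-ends : ∀ ν a xs b {T} → T ℤ.< a ℤ.* a → T ℤ.< b ℤ.* b →
  countNormSq ν (a ∷ xs ++ [ b ]) T ≡ countNormSq ν xs T
countNormSq-drop-ends zero    a xs b T<a² T<b² = refl
countNormSq-drop-ends (suc ν) a xs b {T} T<a² T<b² = begin
  countNormSq (suc ν) ys T
    ≡⟨ countNormSq-suc ν ys T ⟩
  inner a ℕ.+ sum (map inner (xs ++ [ b ]))
    ≡⟨ cong (inner a ℕ.+_) (trans (cong sum (map-++ inner xs [ b ])) (sum-++ (map inner xs) [ inner b ])) ⟩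
  inner a ℕ.+ (sum (map inner xs) ℕ.+ (inner b ℕ.+ 0))
    ≡⟨ cong₂ (λ m n → m ℕ.+ (sum (map inner xs) ℕ.+ (n ℕ.+ 0)))
             (countNormSq-beyond ν ys a T<a²) (countNormSq-beyond ν ys b T<b²) ⟩
  sum (map inner xs) ℕ.+ 0
    ≡⟨ ℕP.+-identityʳ _ ⟩
  sum (map inner xs)
    ≡⟨ cong sum (map-cong inner-drop-ends xs) ⟩
  sum (map (λ x → countNormSq ν xs (T ℤ.- x ℤ.* x)) xs)
    ≡⟨ countNormSq-suc ν xs T ⟨
  countNormSq (suc ν) xs T ∎
  where
  open ≡-Reasoning
  ys = a ∷ xs ++ [ b ]
  inner : ℤ → ℕ
  inner x = countNormSq ν ys (T ℤ.- x ℤ.* x)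
  T-x²≤T : ∀ x → T ℤ.- x ℤ.* x ℤ.≤ T
  T-x²≤T x rewrite i*i≡+∣i∣*∣i∣ x = ℤP.i-j≤i T (+ _)
  inner-drop-ends : ∀ x → inner x ≡ countNormSq ν xs (T ℤ.- x ℤ.* x)
  inner-drop-ends x = countNormSq-drop-ends ν a xs b
    (ℤP.≤-<-trans (T-x²≤T x) T<a²) (ℤP.≤-<-trans (T-x²≤T x) T<b²)

box≡applyUpTo : ∀ B → box B ≡ applyUpTo (_⊖ B) (suc (2 ℕ.* B))
box≡applyUpTo B = trans (map-cong (λ i → ℤP.m-n≡m⊖n i B) (upTo (suc (2 ℕ.* B))))
                        (map-upTo (_⊖ B) (suc (2 ℕ.* B)))

box-suc : ∀ B → box (suc B) ≡ -[1+ B ] ∷ box B ++ [ + suc B ]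
box-suc B = begin
  box (suc B)
    ≡⟨ box≡applyUpTo (suc B) ⟩
  applyUpTo (_⊖ suc B) (suc (2 ℕ.* suc B))
    ≡⟨ cong (λ n → applyUpTo (_⊖ suc B) (suc n)) (ℕP.*-suc 2 B) ⟩
  -[1+ B ] ∷ applyUpTo (λ i → suc i ⊖ suc B) (suc (suc (2 ℕ.* B)))
    ≡⟨ cong (-[1+ B ] ∷_) (applyUpTo-∷ʳ (λ i → suc i ⊖ suc B) (suc (2 ℕ.* B))) ⟨
  -[1+ B ] ∷ applyUpTo (λ i → suc i ⊖ suc B) (suc (2 ℕ.* B)) ∷ʳ (suc (suc (2 ℕ.* B)) ⊖ suc B)
    ≡⟨ cong₂ (λ xs x → -[1+ B ] ∷ xs ∷ʳ x)
             (trans (applyUpTo-cong (λ i → ℤP.[1+m]⊖[1+n]≡m⊖n i B) (suc (2 ℕ.* B))) (sym (box≡applyUpTo B)))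
             last-entry ⟩
  -[1+ B ] ∷ box B ∷ʳ + suc B ∎
  where
  open ≡-Reasoning
  last-entry : suc (suc (2 ℕ.* B)) ⊖ suc B ≡ + suc B
  last-entry = begin
    suc (suc (2 ℕ.* B)) ⊖ suc B     ≡⟨ cong (_⊖ suc B) (double-suc B) ⟩
    (suc B ℕ.+ suc B) ⊖ suc B       ≡⟨ ℤP.⊖-≥ (ℕP.m≤n+m (suc B) (suc B)) ⟩
    + (suc B ℕ.+ suc B ℕ.∸ suc B)   ≡⟨ cong +_ (ℕP.m+n∸n≡m (suc B) (suc B)) ⟩
    + suc B                         ∎
    where
    double-suc : ∀ B → suc (suc (2 ℕ.* B)) ≡ suc B ℕ.+ suc B
    double-suc = ℕ-Solver.solve-∀

countNormSq-box-suc : ∀ ν {B T} → T ℤ.≤ + (B ℕ.* B) →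
  countNormSq ν (box (suc B)) T ≡ countNormSq ν (box B) T
countNormSq-box-suc ν {B} {T} T≤B² =
  trans (cong (λ xs → countNormSq ν xs T) (box-suc B))
        (countNormSq-drop-ends ν -[1+ B ] (box B) (+ suc B) T<[1+B]² T<[1+B]²)
  where
  T<[1+B]² : T ℤ.< + (suc B ℕ.* suc B)
  T<[1+B]² = ℤP.≤-<-trans T≤B² (ℤ.+<+ (ℕP.*-mono-< (ℕP.n<1+n B) (ℕP.n<1+n B)))

countNormSq-box-mono : ∀ ν {B B′ T} → T ℤ.≤ + (B ℕ.* B) → B ≤′ B′ →
  countNormSq ν (box B) T ≡ countNormSq ν (box B′) T
countNormSq-box-mono ν T≤B² ≤′-refl = refl
countNormSq-box-mono ν T≤B² (≤′-step B≤B′) =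
  trans (countNormSq-box-mono ν T≤B² B≤B′)
        (sym (countNormSq-box-suc ν (ℤP.≤-trans T≤B² (ℤ.+≤+ (ℕP.*-mono-≤ B≤B′′ B≤B′′)))))
  where B≤B′′ = ℕP.≤′⇒≤ B≤B′

countNormSq-box-stable : ∀ ν {b B B′ T} → T ℤ.≤ + (b ℕ.* b) → b ≤ B → b ≤ B′ →
  countNormSq ν (box B) T ≡ countNormSq ν (box B′) T
countNormSq-box-stable ν T≤b² b≤B b≤B′ =
  trans (sym (countNormSq-box-mono ν T≤b² (ℕP.≤⇒≤′ b≤B))) (countNormSq-box-mono ν T≤b² (ℕP.≤⇒≤′ b≤B′))

fiber-condition⇔ : ∀ S a d n .{{_ : NonZero d}} →
  (S ℚ./ 1 ≡ ((+ a ℚ./ d) ℚ.* (+ n ℚ./ 1)) ℚ.* ((+ a ℚ./ d) ℚ.* (+ n ℚ./ 1)))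
    ⇔ (S ℤ.* + (d ℕ.* d) ≡ + ((a ℕ.* n) ℕ.* (a ℕ.* n)))
fiber-condition⇔ S a d n = mk⇔
  (λ e → trans (Equivalence.to cross-multiply (trans e (square-of-/ a d n))) (ℤP.*-identityʳ X))
  (λ e → trans (Equivalence.from cross-multiply (trans e (sym (ℤP.*-identityʳ X)))) (sym (square-of-/ a d n)))
  where
  instance _ = ℕP.m*n≢0 d d
  X = + ((a ℕ.* n) ℕ.* (a ℕ.* n))
  cross-multiply = /≡/⇔ S X 1 (d ℕ.* d)

Rterm-nonzero : ∀ ν x₀ n .{{_ : NonZero n}} →
  Rterm ν x₀ n ≡ ((γ n ℤ.* + countFiber ν x₀ n) ℚ./ (n ℕ.^ suc ν)) {{m^n≢0 n (suc ν)}}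
Rterm-nonzero ν x₀ (suc n) = refl

module _ (ν m̃ ñ : ℕ) .{{_ : NonZero ñ}} (coprime : gcd m̃ ñ ≡ 1) where

  private
    x₀ : ℚ
    x₀ = + m̃ ℚ./ ñ

    OnFiber : ℕ → Vec ℤ ν → Set
    OnFiber n v = normSq v ℚ./ 1 ≡ (x₀ ℚ.* (+ n ℚ./ 1)) ℚ.* (x₀ ℚ.* (+ n ℚ./ 1))

  countFiber-vanishes : ∀ n → ¬ ñ ∣ n → countFiber ν x₀ n ≡ 0
  countFiber-vanishes n ñ∤n =
    cong length (filter-none (λ v → normSq v ℚ./ 1 ℚ.≟ _) (All.universal excluded (vecs ν _)))
    where
    ñ⊥m̃ : Coprime ñ m̃
    ñ⊥m̃ = Coprimality.sym (gcd≡1⇒coprime coprime)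
    excluded : ∀ v → ¬ OnFiber n v
    excluded v onFiber = ñ∤n (coprime-divisor {ñ} {m̃} {n} ñ⊥m̃
                                (m*m∣n*n⇒m∣n ñ (m̃ ℕ.* n) (divides s (sym s*ñ²≡[m̃n]²))))
      where
      s = ℤ.∣ normSq v ∣
      s*ñ²≡[m̃n]² : s ℕ.* (ñ ℕ.* ñ) ≡ (m̃ ℕ.* n) ℕ.* (m̃ ℕ.* n)
      s*ñ²≡[m̃n]² = ℤP.+-injective (begin
        + (s ℕ.* (ñ ℕ.* ñ))            ≡⟨ ℤP.pos-* s (ñ ℕ.* ñ) ⟩
        + s ℤ.* + (ñ ℕ.* ñ)            ≡⟨ cong (ℤ._* + (ñ ℕ.* ñ)) (ℤP.0≤i⇒+∣i∣≡i (normSq-nonneg v)) ⟩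
        normSq v ℤ.* + (ñ ℕ.* ñ)       ≡⟨ Equivalence.to (fiber-condition⇔ (normSq v) m̃ ñ n) onFiber ⟩
        + ((m̃ ℕ.* n) ℕ.* (m̃ ℕ.* n))   ∎)
        where open ≡-Reasoning

  countFiber-multiple : ∀ k → countFiber ν x₀ (k ℕ.* ñ) ≡ r ν (k ℕ.* k ℕ.* (m̃ ℕ.* m̃))
  countFiber-multiple k = begin
    countFiber ν x₀ (k ℕ.* ñ)
      ≡⟨ cong length (filter-≐ _ _ ((λ {v} → to {v}) , (λ {v} → from {v})) (vecs ν (box width))) ⟩
    countNormSq ν (box width) (+ K)
      ≡⟨ countNormSq-box-stable ν (ℤ.+≤+ (ℕP.≤-reflexive K≡b²)) b≤width (subst (b ≤_) (sym K≡b²) (m≤m*m b)) ⟩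
    countNormSq ν (box K) (+ K) ∎
    where
    open ≡-Reasoning
    width = ℤ.∣ ℚ.↥ x₀ ∣ ℕ.* (k ℕ.* ñ)
    K = k ℕ.* k ℕ.* (m̃ ℕ.* m̃)
    b = m̃ ℕ.* k
    K≡b² : K ≡ b ℕ.* b
    K≡b² = solve m̃ k
      where
      solve : ∀ m k → k ℕ.* k ℕ.* (m ℕ.* m) ≡ (m ℕ.* k) ℕ.* (m ℕ.* k)
      solve = ℕ-Solver.solve-∀
    [m̃kñ]²≡Kñ² : + ((m̃ ℕ.* (k ℕ.* ñ)) ℕ.* (m̃ ℕ.* (k ℕ.* ñ))) ≡ + K ℤ.* + (ñ ℕ.* ñ)
    [m̃kñ]²≡Kñ² = trans (cong +_ (solve m̃ k ñ)) (ℤP.pos-* K (ñ ℕ.* ñ))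
      where
      solve : ∀ m k n → (m ℕ.* (k ℕ.* n)) ℕ.* (m ℕ.* (k ℕ.* n)) ≡ (k ℕ.* k ℕ.* (m ℕ.* m)) ℕ.* (n ℕ.* n)
      solve = ℕ-Solver.solve-∀
    b≤width : b ≤ width
    b≤width = subst (λ i → b ≤ ℤ.∣ i ∣ ℕ.* (k ℕ.* ñ)) (sym (↥-/-coprime m̃ ñ coprime))
                (ℕP.*-monoʳ-≤ m̃ (ℕP.m≤m*n k ñ))
    to : ∀ {v} → OnFiber (k ℕ.* ñ) v → normSq v ≡ + K
    to {v} onFiber = ℤP.*-cancelʳ-≡ (normSq v) (+ K) (+ (ñ ℕ.* ñ)) {{ℕP.m*n≢0 ñ ñ}}
      (trans (Equivalence.to (fiber-condition⇔ (normSq v) m̃ ñ (k ℕ.* ñ)) onFiber) [m̃kñ]²≡Kñ²)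
    from : ∀ {v} → normSq v ≡ + K → OnFiber (k ℕ.* ñ) v
    from {v} normSq≡K = Equivalence.from (fiber-condition⇔ (normSq v) m̃ ñ (k ℕ.* ñ))
      (trans (cong (ℤ._* + (ñ ℕ.* ñ)) normSq≡K) (sym [m̃kñ]²≡Kñ²))

  Rterm-vanishes : ∀ n → ¬ ñ ∣ n → Rterm ν x₀ n ≡ ℚ.0ℚ
  Rterm-vanishes zero    _   = refl
  Rterm-vanishes (suc n) ñ∤n = begin
    Rterm ν x₀ (suc n)
      ≡⟨ cong (λ c → (γ (suc n) ℤ.* + c) ℚ./ (suc n ℕ.^ suc ν)) (countFiber-vanishes (suc n) ñ∤n) ⟩
    (γ (suc n) ℤ.* 0ℤ) ℚ./ (suc n ℕ.^ suc ν)
      ≡⟨ cong (ℚ._/ (suc n ℕ.^ suc ν)) (ℤP.*-zeroʳ (γ (suc n))) ⟩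
    0ℤ ℚ./ (suc n ℕ.^ suc ν)
      ≡⟨ ℚP.0/n≡0 (suc n ℕ.^ suc ν) ⟩
    ℚ.0ℚ ∎
    where
    open ≡-Reasoning
    instance _ = m^n≢0 (suc n) (suc ν)

  Rterm-multiple : ∀ k → Rterm ν x₀ (k ℕ.* ñ) ≡ ((+ 1 ℚ./ (ñ ℕ.^ suc ν)) {{m^n≢0 ñ (suc ν)}}) ℚ.* RHSterm ν m̃ ñ k
  Rterm-multiple zero    = sym (ℚP.*-zeroʳ ((+ 1 ℚ./ (ñ ℕ.^ suc ν)) {{m^n≢0 ñ (suc ν)}}))
  Rterm-multiple (suc j) = begin
    Rterm ν x₀ (k ℕ.* ñ)
      ≡⟨ Rterm-nonzero ν x₀ (k ℕ.* ñ) ⟩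
    (γ (k ℕ.* ñ) ℤ.* + countFiber ν x₀ (k ℕ.* ñ)) ℚ./ ((k ℕ.* ñ) ℕ.^ e)
      ≡⟨ cong (λ c → (γ (k ℕ.* ñ) ℤ.* + c) ℚ./ ((k ℕ.* ñ) ℕ.^ e)) (countFiber-multiple k) ⟩
    num ℚ./ ((k ℕ.* ñ) ℕ.^ e)
      ≡⟨ ℚP./-cong (sym (ℤP.*-identityˡ num)) (trans (^-distribʳ-* k ñ e) (ℕP.*-comm (k ℕ.^ e) (ñ ℕ.^ e))) ⟩
    (+ 1 ℤ.* num) ℚ./ (ñ ℕ.^ e ℕ.* k ℕ.^ e)
      ≡⟨ /-* (+ 1) num (ñ ℕ.^ e) (k ℕ.^ e) ⟨
    (+ 1 ℚ./ (ñ ℕ.^ e)) ℚ.* (num ℚ./ (k ℕ.^ e)) ∎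
    where
    open ≡-Reasoning
    k = suc j
    e = suc ν
    num = γ (k ℕ.* ñ) ℤ.* + r ν (k ℕ.* k ℕ.* (m̃ ℕ.* m̃))
    instance
      _ = ℕP.m*n≢0 k ñ
      _ = m^n≢0 (k ℕ.* ñ) e
      _ = m^n≢0 ñ e
      _ = m^n≢0 k e
      _ = ℕP.m*n≢0 (ñ ℕ.^ e) (k ℕ.^ e)

lemma2p3 : (ν : ℕ) → 2 ≤ ν → (m̃ ñ : ℕ) → 0 < m̃ → (nz : NonZero ñ) → gcd m̃ ñ ≡ 1 →
    (N : ℕ) →
    Rpartial ν ((+ m̃ ℚ./ ñ) {{nz}}) N
      ≡ ((+ 1 ℚ./ (ñ ℕ.^ suc ν)) {{m^n≢0 ñ (suc ν) {{nz}}}})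
          ℚ.* Σ₁ ((N ℕ./ ñ) {{nz}}) (RHSterm ν m̃ ñ)
lemma2p3 ν _ m̃ ñ _ nz coprime N = begin
  Rpartial ν (+ m̃ ℚ./ ñ) N
    ≡⟨ Σ₁-sparse ñ (Rterm ν (+ m̃ ℚ./ ñ)) (λ k → c ℚ.* RHSterm ν m̃ ñ k)
                 (Rterm-vanishes ν m̃ ñ coprime) (Rterm-multiple ν m̃ ñ coprime) N ⟩
  Σ₁ (N / ñ) (λ k → c ℚ.* RHSterm ν m̃ ñ k)
    ≡⟨ Σ₁-*ˡ c (N / ñ) (RHSterm ν m̃ ñ) ⟩
  c ℚ.* Σ₁ (N / ñ) (RHSterm ν m̃ ñ) ∎
  where
  open ≡-Reasoning
  instance _ = nz
  c = (+ 1 ℚ./ (ñ ℕ.^ suc ν)) {{m^n≢0 ñ (suc ν)}}
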